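{- Let $E: y^2=x^3+ax^2+bx+c$ ($a,b,c\in\mathbb{Z}$) be an elliptic curve and $P\in E(\mathbb{Q})$ a point of infinite order. For every $k\ge1$, the number $\tau_k=\frac{2n_{k-1}}{F_k(E,P)}$ is an integer.
   Context: An elliptic curve is a non-singular cubic $y^2=x^3+ax^2+bx+c$ with $a,b,c\in\mathbb{Z}$. For $k\ge0$ write $2^kP=\left(\frac{m_k}{e_k^2},\frac{n_k}{e_k^3}\right)$ with $m_k,n_k,e_k\in\mathbb{Z}$, $e_k\ge1$, $\gcd(m_k,e_k)=\gcd(n_k,e_k)=1$. Define $F_0(E,P)=e_0$ and $F_k(E,P)=e_k/e_{k-1}$ for $k\ge1$. -}

module Defs where

open import Data.Nat as ℕ using (ℕ; zero; suc)
open import Data.Nat.GCD using (gcd)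
import Data.Integer as Z
open Z using (ℤ; +_)
open import Data.Rational as ℚ using (ℚ; _/_; _+_; _*_; _-_; _÷_; ≢-nonZero)
open import Data.Rational.Properties using (_≟_)
open import Relation.Nullary using (yes; no; ¬_)
open import Relation.Binary.PropositionalEquality using (_≡_; _≢_)
open import Data.Product using (_×_; Σ)
open import Data.Unit using (⊤)

ι : ℤ → ℚ
ι i = i / 1

-- the curve  y² = x³ + a x² + b x + c  with integer coefficients
record Curve : Set where
  constructor curve
  field
    a b c : ℤ

open Curve public

disc : Curve → ℤ
disc E = let open Z using () renaming (_*_ to _⊗_; _-_ to _⊖_; _+_ to _⊕_) in
  ((((a E ⊗ a E ⊗ b E ⊗ b E) ⊖ (+ 4 ⊗ b E ⊗ b E ⊗ b E)) ⊖ (+ 4 ⊗ a E ⊗ a E ⊗ a E ⊗ c E))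
    ⊖ (+ 27 ⊗ c E ⊗ c E)) ⊕ (+ 18 ⊗ a E ⊗ b E ⊗ c E)

NonSingular : Curve → Set
NonSingular E = disc E ≢ + 0

data Pt : Set where
  O  : Pt
  af : ℚ → ℚ → Pt

OnCurve : Curve → Pt → Set
OnCurve E O = ⊤
OnCurve E (af x y) = y * y ≡ x * x * x + ι (a E) * x * x + ι (b E) * x + ι (c E)

add : Curve → Pt → Pt → Pt
add E O Q = Q
add E P O = P
add E (af x₁ y₁) (af x₂ y₂) with x₂ - x₁ ≟ ℚ.0ℚ
... | no d≢0 =
  let instance _ = ≢-nonZero d≢0
      λ′ = (y₂ - y₁) ÷ (x₂ - x₁)
      x₃ = λ′ * λ′ - ι (a E) - x₁ - x₂
  in af x₃ (λ′ * (x₁ - x₃) - y₁)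
... | yes _ with y₁ + y₂ ≟ ℚ.0ℚ
...   | yes _ = O
...   | no _ with ι (+ 2) * y₁ ≟ ℚ.0ℚ
...     | yes _ = O  -- unreachable for points on the curve
...     | no 2y₁≢0 =
  let instance _ = ≢-nonZero 2y₁≢0
      λ′ = (ι (+ 3) * x₁ * x₁ + ι (+ 2) * ι (a E) * x₁ + ι (b E)) ÷ (ι (+ 2) * y₁)
      x₃ = λ′ * λ′ - ι (a E) - x₁ - x₁
  in af x₃ (λ′ * (x₁ - x₃) - y₁)

mul : Curve → ℕ → Pt → Pt
mul E zero P = O
mul E (suc n) P = add E P (mul E n P)

InfiniteOrder : Curve → Pt → Set
InfiniteOrder E P = ∀ n → mul E (suc n) P ≢ O

pow2 : Curve → ℕ → Pt → Pt
pow2 E zero P = P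
pow2 E (suc k) P = let Q = pow2 E k P in add E Q Q

-- i / d as a rational (d = 0 never occurs below: it is excluded by e ≥ 1)
frac : ℤ → ℕ → ℚ
frac i zero = ℚ.0ℚ
frac i (suc d) = i / suc d

Rep : Pt → ℤ → ℤ → ℕ → Set
Rep Q m n e =
  (1 ℕ.≤ e) × (gcd (Z.∣ m ∣) e ≡ 1) × (gcd (Z.∣ n ∣) e ≡ 1) ×
  (Q ≡ af (frac m (e ℕ.^ 2)) (frac n (e ℕ.^ 3)))

F : ℕ → ℕ → ℚ
F eₖ₋₁ eₖ = frac (+ eₖ) eₖ₋₁

τ : ℤ → ℕ → ℕ → ℚ
τ nₖ₋₁ eₖ₋₁ eₖ with F eₖ₋₁ eₖ ≟ ℚ.0ℚ
... | yes _ = ℚ.0ℚ   -- never occurs (e_k ≥ 1)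
... | no F≢0 = let instance _ = ≢-nonZero F≢0 in ι (Z._*_ (+ 2) nₖ₋₁) ÷ F eₖ₋₁ eₖ

IsInteger : ℚ → Set
IsInteger q = Σ ℤ (λ t → q ≡ ι t)

{-# OPTIONS --safe #-}
-- Write Q = 2ᵏP = (m/e², n/e³) and 2Q = (m′/e′², n′/e′³). The tangent-line doubling formula
-- gives x(2Q)·(2ne)² = Φ(m, n, e) for an integer polynomial Φ, so e′² divides m′(2ne)²;
-- as gcd(m′, e′) = 1, e′² ∣ (2ne)², hence e′ ∣ 2ne and τ = 2n/(e′/e) = 2ne/e′ is an integer.
module Submission where

open import Defs
open import Data.Nat as ℕ using (ℕ; suc; NonZero)
open import Data.Nat.Coprimality using (Coprime; coprime-divisor; coprime-/gcd; gcd≡1⇒coprime)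
import Data.Nat.Coprimality as Coprime
open import Data.Nat.Divisibility as ℕ using (∣-refl; ∣-trans; m∣m*n; *-cancelʳ-∣)
open import Data.Nat.DivMod using (_/_; m/n*n≡m)
open import Data.Nat.GCD using (gcd; gcd[m,n]∣m; gcd[m,n]∣n; gcd[m,n]≢0)
import Data.Nat.Properties as ℕ
import Data.Nat.Solver as ℕ-Solver
open import Data.Integer as ℤ using (ℤ; +_; ∣_∣)
import Data.Integer.Properties as ℤ
import Data.Integer.Divisibility as ℤᵘ
import Data.Integer.Divisibility.Signed as ℤˢ
open import Data.Rational as ℚ using (ℚ; _+_; _*_; _-_; -_; _÷_; 0ℚ; 1ℚ; 1/_)
import Data.Rational.Properties as ℚ
open import Data.Rational.Properties using (_≟_)
import Data.Rational.Solver as ℚ-Solver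
import Data.Rational.Unnormalised as ℚᵘ
import Data.Rational.Unnormalised.Properties as ℚᵘ
open import Data.Product using (_,_)
open import Data.Sum using (inj₁)
open import Relation.Nullary using (yes; no; contradiction)
open import Relation.Binary.PropositionalEquality
open import Function using (case_of_)

infix 8 _²
_² : ℚ → ℚ
p ² = p * p

private
  toℚᵘ-ι : ∀ i → ℚ.toℚᵘ (ι i) ℚᵘ.≃ ℚᵘ.mkℚᵘ i 0
  toℚᵘ-ι i = ℚ.toℚᵘ-fromℚᵘ (ℚᵘ.mkℚᵘ i 0)

ι-+ : ∀ i j → ι (i ℤ.+ j) ≡ ι i + ι j
ι-+ i j = ℚ.toℚᵘ-injective (begin
  ℚ.toℚᵘ (ι (i ℤ.+ j))            ≈⟨ toℚᵘ-ι (i ℤ.+ j) ⟩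
  ℚᵘ.mkℚᵘ (i ℤ.+ j) 0              ≈⟨ ℚᵘ.*≡* cross-multiplied ⟩
  ℚᵘ.mkℚᵘ i 0 ℚᵘ.+ ℚᵘ.mkℚᵘ j 0     ≈⟨ ℚᵘ.+-cong (toℚᵘ-ι i) (toℚᵘ-ι j) ⟨
  ℚ.toℚᵘ (ι i) ℚᵘ.+ ℚ.toℚᵘ (ι j)   ≈⟨ ℚ.toℚᵘ-homo-+ (ι i) (ι j) ⟨
  ℚ.toℚᵘ (ι i + ι j)              ∎)
  where
  open ℚᵘ.≃-Reasoning
  cross-multiplied : (i ℤ.+ j) ℤ.* + 1 ≡ (i ℤ.* + 1 ℤ.+ j ℤ.* + 1) ℤ.* + 1
  cross-multiplied = cong (ℤ._* + 1) (sym (cong₂ ℤ._+_ (ℤ.*-identityʳ i) (ℤ.*-identityʳ j)))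

ι-* : ∀ i j → ι (i ℤ.* j) ≡ ι i * ι j
ι-* i j = ℚ.toℚᵘ-injective (begin
  ℚ.toℚᵘ (ι (i ℤ.* j))            ≈⟨ toℚᵘ-ι (i ℤ.* j) ⟩
  ℚᵘ.mkℚᵘ (i ℤ.* j) 0              ≈⟨ ℚᵘ.*-cong (toℚᵘ-ι i) (toℚᵘ-ι j) ⟨
  ℚ.toℚᵘ (ι i) ℚᵘ.* ℚ.toℚᵘ (ι j)   ≈⟨ ℚ.toℚᵘ-homo-* (ι i) (ι j) ⟨
  ℚ.toℚᵘ (ι i * ι j)              ∎)
  where open ℚᵘ.≃-Reasoning

ι-neg : ∀ i → ι (ℤ.- i) ≡ - ι i
ι-neg i = ℚ.toℚᵘ-injective (begin
  ℚ.toℚᵘ (ι (ℤ.- i))    ≈⟨ toℚᵘ-ι (ℤ.- i) ⟩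
  ℚᵘ.mkℚᵘ (ℤ.- i) 0      ≈⟨ ℚᵘ.-‿cong (toℚᵘ-ι i) ⟨
  ℚᵘ.- ℚ.toℚᵘ (ι i)      ≈⟨ ℚ.toℚᵘ-homo‿- (ι i) ⟨
  ℚ.toℚᵘ (- ι i)        ∎)
  where open ℚᵘ.≃-Reasoning

ι-injective : ∀ {i j} → ι i ≡ ι j → i ≡ j
ι-injective {i} {j} ιi≡ιj
  with ℚᵘ.≃-trans (ℚᵘ.≃-sym (toℚᵘ-ι i)) (ℚᵘ.≃-trans (ℚ.toℚᵘ-cong ιi≡ιj) (toℚᵘ-ι j))
... | ℚᵘ.*≡* i*1≡j*1 = trans (sym (ℤ.*-identityʳ i)) (trans i*1≡j*1 (ℤ.*-identityʳ j))

ι-pos-* : ∀ m n → ι (+ (m ℕ.* n)) ≡ ι (+ m) * ι (+ n)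
ι-pos-* m n = trans (cong ι (ℤ.pos-* m n)) (ι-* (+ m) (+ n))

ι-square : ∀ e → ι (+ (e ℕ.^ 2)) ≡ ι (+ e) ²
ι-square e = trans (ι-pos-* e (e ℕ.^ 1)) (cong (λ k → ι (+ e) * ι (+ k)) (ℕ.^-identityʳ e))

ι-cube : ∀ e → ι (+ (e ℕ.^ 3)) ≡ ι (+ e) * ι (+ e) ²
ι-cube e = trans (ι-pos-* e (e ℕ.^ 2)) (cong (ι (+ e) *_) (ι-square e))

ι-pos≢0 : ∀ d .{{_ : NonZero d}} → ι (+ d) ≢ 0ℚ
ι-pos≢0 (suc d) ι-suc≡0 with ι-injective {+ suc d} {+ 0} ι-suc≡0
... | ()

frac-*-cancel : ∀ i d .{{_ : NonZero d}} → ι (+ d) * frac i d ≡ ι i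
frac-*-cancel i (suc q) = ℚ.toℚᵘ-injective (begin
  ℚ.toℚᵘ (ι (+ suc q) * frac i (suc q))
    ≈⟨ ℚ.toℚᵘ-homo-* (ι (+ suc q)) (frac i (suc q)) ⟩
  ℚ.toℚᵘ (ι (+ suc q)) ℚᵘ.* ℚ.toℚᵘ (frac i (suc q))
    ≈⟨ ℚᵘ.*-cong (toℚᵘ-ι (+ suc q)) (ℚ.toℚᵘ-fromℚᵘ (ℚᵘ.mkℚᵘ i q)) ⟩
  ℚᵘ.mkℚᵘ (+ suc q) 0 ℚᵘ.* ℚᵘ.mkℚᵘ i q
    ≈⟨ ℚᵘ.*≡* cross-multiplied ⟩
  ℚᵘ.mkℚᵘ i 0
    ≈⟨ toℚᵘ-ι i ⟨
  ℚ.toℚᵘ (ι i)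
    ∎)
  where
  open ℚᵘ.≃-Reasoning
  cross-multiplied : + suc q ℤ.* i ℤ.* + 1 ≡ i ℤ.* + suc (q ℕ.+ 0)
  cross-multiplied = trans (ℤ.*-identityʳ _)
    (trans (ℤ.*-comm (+ suc q) i) (cong (λ k → i ℤ.* + suc k) (sym (ℕ.+-identityʳ q))))

÷-*-cancelʳ : ∀ p q .{{_ : ℚ.NonZero q}} → p ÷ q * q ≡ p
÷-*-cancelʳ p q = begin
  p * 1/ q * q    ≡⟨ ℚ.*-assoc p (1/ q) q ⟩
  p * (1/ q * q)  ≡⟨ cong (p *_) (ℚ.*-inverseˡ q) ⟩
  p * 1ℚ          ≡⟨ ℚ.*-identityʳ p ⟩
  p               ∎
  where open ≡-Reasoning

*-÷-cancelʳ : ∀ p q .{{_ : ℚ.NonZero q}} → p * q ÷ q ≡ p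
*-÷-cancelʳ p q = begin
  p * q * 1/ q    ≡⟨ ℚ.*-assoc p q (1/ q) ⟩
  p * (q * 1/ q)  ≡⟨ cong (p *_) (ℚ.*-inverseʳ q) ⟩
  p * 1ℚ          ≡⟨ ℚ.*-identityʳ p ⟩
  p               ∎
  where open ≡-Reasoning

*-cancelʳ-≡ : ∀ {p q} r .{{_ : ℚ.NonZero r}} → p * r ≡ q * r → p ≡ q
*-cancelʳ-≡ {p} {q} r p*r≡q*r = begin
  p          ≡⟨ *-÷-cancelʳ p r ⟨
  p * r ÷ r  ≡⟨ cong (_÷ r) p*r≡q*r ⟩
  q * r ÷ r  ≡⟨ *-÷-cancelʳ q r ⟩
  q          ∎
  where open ≡-Reasoning

+-isInteger : ∀ {p q} → IsInteger p → IsInteger q → IsInteger (p + q)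
+-isInteger (i , refl) (j , refl) = i ℤ.+ j , sym (ι-+ i j)

*-isInteger : ∀ {p q} → IsInteger p → IsInteger q → IsInteger (p * q)
*-isInteger (i , refl) (j , refl) = i ℤ.* j , sym (ι-* i j)

-‿isInteger : ∀ {p} → IsInteger p → IsInteger (- p)
-‿isInteger (i , refl) = ℤ.- i , sym (ι-neg i)

-isInteger : ∀ {p q} → IsInteger p → IsInteger q → IsInteger (p - q)
-isInteger p∈ℤ q∈ℤ = +-isInteger p∈ℤ (-‿isInteger q∈ℤ)

ι-isInteger : ∀ i → IsInteger (ι i)
ι-isInteger i = i , refl

f′ : Curve → ℚ → ℚ
f′ E x = ι (+ 3) * x * x + ι (+ 2) * ι (a E) * x + ι (b E)

af-injectiveˡ : ∀ {x y x′ y′} → af x y ≡ af x′ y′ → x ≡ x′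
af-injectiveˡ refl = refl

doubling-x : ∀ E {x y x₂ y₂} → add E (af x y) (af x y) ≡ af x₂ y₂ →
  x₂ * (ι (+ 2) * y) ² ≡ f′ E x ² - (ι (a E) + ι (+ 2) * x) * (ι (+ 2) * y) ²
doubling-x E {x} {y} {x₂} H with x - x ≟ 0ℚ
... | no x-x≢0 = contradiction (ℚ.+-inverseʳ x) x-x≢0
... | yes _ with y + y ≟ 0ℚ
...   | yes _ = case H of λ ()
...   | no _ with ι (+ 2) * y ≟ 0ℚ
...     | yes _ = case H of λ ()
...     | no 2y≢0 = begin
  x₂ * 2y ²                        ≡⟨ cong (_* 2y ²) (af-injectiveˡ H) ⟨
  (λ′ ² - A - x - x) * 2y ²        ≡⟨ tangent-identity λ′ A x y ⟩
  (λ′ * 2y) ² - (A + 2x) * 2y ²    ≡⟨ cong (λ s → s ² - (A + 2x) * 2y ²) (÷-*-cancelʳ (f′ E x) 2y) ⟩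
  f′ E x ² - (A + 2x) * 2y ²       ∎
  where
  open ≡-Reasoning
  instance _ = ℚ.≢-nonZero 2y≢0
  A = ι (a E)
  2x = ι (+ 2) * x
  2y = ι (+ 2) * y
  λ′ = f′ E x ÷ 2y
  tangent-identity : ∀ l A x y →
    (l ² - A - x - x) * (ι (+ 2) * y) ² ≡ (l * (ι (+ 2) * y)) ² - (A + ι (+ 2) * x) * (ι (+ 2) * y) ²
  tangent-identity = solve 4 (λ l A x y →
    (l :* l :- A :- x :- x) :* (κ₂ :* y :* (κ₂ :* y))
      := l :* (κ₂ :* y) :* (l :* (κ₂ :* y)) :- (A :+ κ₂ :* x) :* (κ₂ :* y :* (κ₂ :* y))) refl
    where open ℚ-Solver.+-*-Solver
          κ₂ = con (ι (+ 2))

f′-homogeneous : Curve → ℚ → ℚ → ℚ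
f′-homogeneous E e m = ι (+ 3) * m * m + ι (+ 2) * ι (a E) * m * e ² + ι (b E) * e ² * e ²

-- For Q = (m/e², n/e³), the doubling formula reads x(2Q) = doubling-numerator E e m n / (2ne)².
doubling-numerator : Curve → ℚ → ℚ → ℚ → ℚ
doubling-numerator E e m n = f′-homogeneous E e m ² - (ι (a E) * e ² + ι (+ 2) * m) * (ι (+ 2) * n) ²

doubling-numerator-isInteger : ∀ E e m n → IsInteger (doubling-numerator E (ι e) (ι m) (ι n))
doubling-numerator-isInteger E e m n =
  -isInteger (*-isInteger f′ʰ f′ʰ)
             (*-isInteger (+-isInteger (*-isInteger A e²) (*-isInteger 2ℤ M)) (*-isInteger 2N 2N))
  where
  A = ι-isInteger (a E)
  B = ι-isInteger (b E)
  M = ι-isInteger m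
  2ℤ = ι-isInteger (+ 2)
  e² = *-isInteger (ι-isInteger e) (ι-isInteger e)
  2N = *-isInteger 2ℤ (ι-isInteger n)
  f′ʰ = +-isInteger (+-isInteger (*-isInteger (*-isInteger (ι-isInteger (+ 3)) M) M)
                                 (*-isInteger (*-isInteger (*-isInteger 2ℤ A) M) e²))
                    (*-isInteger (*-isInteger B e²) e²)

doubling-x-homogeneous : ∀ E e {x y x₂} →
  x₂ * (ι (+ 2) * y) ² ≡ f′ E x ² - (ι (a E) + ι (+ 2) * x) * (ι (+ 2) * y) ² →
  x₂ * (ι (+ 2) * (e * e ² * y) * e) ² ≡ doubling-numerator E e (e ² * x) (e * e ² * y)
doubling-x-homogeneous E e {x} {y} {x₂} doubling = begin
  x₂ * (ι (+ 2) * (e * e ² * y) * e) ²                     ≡⟨ lhs-identity x₂ e y ⟩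
  e ² ² ² * (x₂ * (ι (+ 2) * y) ²)                         ≡⟨ cong (e ² ² ² *_) doubling ⟩
  e ² ² ² * (f′ E x ² - (A + ι (+ 2) * x) * (ι (+ 2) * y) ²) ≡⟨ rhs-identity A (ι (b E)) e x y ⟩
  doubling-numerator E e (e ² * x) (e * e ² * y)           ∎
  where
  open ≡-Reasoning
  open ℚ-Solver.+-*-Solver
  A = ι (a E)
  κ : ℤ → ∀ {k} → Polynomial k
  κ i = con (ι i)
  _²′ : ∀ {k} → Polynomial k → Polynomial k
  p ²′ = p :* p
  lhs-identity : ∀ x₂ e y → x₂ * (ι (+ 2) * (e * e ² * y) * e) ² ≡ e ² ² ² * (x₂ * (ι (+ 2) * y) ²)
  lhs-identity = solve 3 (λ x₂ e y →
    x₂ :* (κ (+ 2) :* (e :* e ²′ :* y) :* e) ²′ := e ²′ ²′ ²′ :* (x₂ :* (κ (+ 2) :* y) ²′)) refl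
  rhs-identity : ∀ A B e x y →
    e ² ² ² * ((ι (+ 3) * x * x + ι (+ 2) * A * x + B) ² - (A + ι (+ 2) * x) * (ι (+ 2) * y) ²) ≡
    (ι (+ 3) * (e ² * x) * (e ² * x) + ι (+ 2) * A * (e ² * x) * e ² + B * e ² * e ²) ²
      - (A * e ² + ι (+ 2) * (e ² * x)) * (ι (+ 2) * (e * e ² * y)) ²
  rhs-identity = solve 5 (λ A B e x y →
    let m = e ²′ :* x
        n = e :* e ²′ :* y
        f′ˣ = κ (+ 3) :* x :* x :+ κ (+ 2) :* A :* x :+ B
    in e ²′ ²′ ²′ :* (f′ˣ ²′ :- (A :+ κ (+ 2) :* x) :* (κ (+ 2) :* y) ²′)
       := (κ (+ 3) :* m :* m :+ κ (+ 2) :* A :* m :* e ²′ :+ B :* e ²′ :* e ²′) ²′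
            :- (A :* e ²′ :+ κ (+ 2) :* m) :* (κ (+ 2) :* n) ²′) refl

doubling-x-isInteger : ∀ E m n e .{{_ : NonZero e}} {x₂ y₂} →
  let Q = af (frac m (e ℕ.^ 2)) (frac n (e ℕ.^ 3)) in add E Q Q ≡ af x₂ y₂ →
  IsInteger (x₂ * ι ((+ 2 ℤ.* n ℤ.* + e) ℤ.* (+ 2 ℤ.* n ℤ.* + e)))
doubling-x-isInteger E m n e {x₂} doubling =
  subst IsInteger (sym x₂D²≡numerator) (doubling-numerator-isInteger E (+ e) m n)
  where
  instance _ = ℕ.m^n≢0 e 2
  instance _ = ℕ.m^n≢0 e 3
  ε = ι (+ e)
  x = frac m (e ℕ.^ 2)
  y = frac n (e ℕ.^ 3)
  D = + 2 ℤ.* n ℤ.* + e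
  ε²x≡m : ε ² * x ≡ ι m
  ε²x≡m = trans (cong (_* x) (sym (ι-square e))) (frac-*-cancel m (e ℕ.^ 2))
  ε³y≡n : ε * ε ² * y ≡ ι n
  ε³y≡n = trans (cong (_* y) (sym (ι-cube e))) (frac-*-cancel n (e ℕ.^ 3))
  ιD : ι D ≡ ι (+ 2) * (ε * ε ² * y) * ε
  ιD = trans (ι-* (+ 2 ℤ.* n) (+ e))
    (cong (_* ε) (trans (ι-* (+ 2) n) (cong (ι (+ 2) *_) (sym ε³y≡n))))
  x₂D²≡numerator : x₂ * ι (D ℤ.* D) ≡ doubling-numerator E ε (ι m) (ι n)
  x₂D²≡numerator = begin
    x₂ * ι (D ℤ.* D)
      ≡⟨ cong (x₂ *_) (trans (ι-* D D) (cong _² ιD)) ⟩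
    x₂ * (ι (+ 2) * (ε * ε ² * y) * ε) ²
      ≡⟨ doubling-x-homogeneous E ε {x} {y} {x₂} (doubling-x E {x} {y} doubling) ⟩
    doubling-numerator E ε (ε ² * x) (ε * ε ² * y)
      ≡⟨ cong₂ (doubling-numerator E ε) ε²x≡m ε³y≡n ⟩
    doubling-numerator E ε (ι m) (ι n)
      ∎
    where open ≡-Reasoning

frac-*-isInteger⇒∣ : ∀ i d .{{_ : NonZero d}} j → IsInteger (frac i d * ι j) → + d ℤᵘ.∣ i ℤ.* j
frac-*-isInteger⇒∣ i d j (r , i/d*j≡r) =
  ℤˢ.∣⇒∣ᵤ {+ d} {i ℤ.* j} (ℤˢ.divides r (ι-injective (begin
  ι (i ℤ.* j)                  ≡⟨ ι-* i j ⟩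
  ι i * ι j                    ≡⟨ cong (_* ι j) (frac-*-cancel i d) ⟨
  ι (+ d) * frac i d * ι j     ≡⟨ ℚ.*-assoc (ι (+ d)) (frac i d) (ι j) ⟩
  ι (+ d) * (frac i d * ι j)   ≡⟨ cong (ι (+ d) *_) i/d*j≡r ⟩
  ι (+ d) * ι r                ≡⟨ ℚ.*-comm (ι (+ d)) (ι r) ⟩
  ι r * ι (+ d)                ≡⟨ ι-* r (+ d) ⟨
  ι (r ℤ.* + d)                ∎)))
  where open ≡-Reasoning

coprime-* : ∀ {m n o} → Coprime m o → Coprime n o → Coprime (m ℕ.* n) o
coprime-* {m} m⊥o n⊥o {d} (d∣mn , d∣o) = n⊥o (coprime-divisor d⊥m d∣mn , d∣o)
  where
  d⊥m : Coprime d m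
  d⊥m (i∣d , i∣m) = m⊥o (i∣m , ∣-trans i∣d d∣o)

m*m∣n*n⇒m∣n : ∀ m n .{{_ : NonZero m}} → m ℕ.* m ℕ.∣ n ℕ.* n → m ℕ.∣ n
m*m∣n*n⇒m∣n m n m²∣n² = subst (ℕ._∣ n) g≡m (gcd[m,n]∣n m n)
  where
  -- u = m/g and v = n/g are coprime, so u ∣ v² forces u = 1.
  g = gcd m n
  instance _ = ℕ.≢-nonZero (gcd[m,n]≢0 m n (inj₁ (ℕ.≢-nonZero⁻¹ m)))
  instance _ = ℕ.m*n≢0 g g
  u = m / g
  v = n / g
  u*g≡m : u ℕ.* g ≡ m
  u*g≡m = m/n*n≡m (gcd[m,n]∣m m n)
  v*g≡n : v ℕ.* g ≡ n
  v*g≡n = m/n*n≡m (gcd[m,n]∣n m n)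
  square-* : ∀ s t → s ℕ.* t ℕ.* (s ℕ.* t) ≡ s ℕ.* s ℕ.* (t ℕ.* t)
  square-* = solve 2 (λ s t → s :* t :* (s :* t) := s :* s :* (t :* t)) refl
    where open ℕ-Solver.+-*-Solver
  u²∣v² : u ℕ.* u ℕ.∣ v ℕ.* v
  u²∣v² = *-cancelʳ-∣ (g ℕ.* g) (subst₂ ℕ._∣_
    (trans (cong₂ ℕ._*_ (sym u*g≡m) (sym u*g≡m)) (square-* u g))
    (trans (cong₂ ℕ._*_ (sym v*g≡n) (sym v*g≡n)) (square-* v g)) m²∣n²)
  u≡1 : u ≡ 1
  u≡1 = coprime-/gcd m n (∣-refl , coprime-divisor (coprime-/gcd m n) (∣-trans (m∣m*n u) u²∣v²))
  g≡m : g ≡ m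
  g≡m = trans (sym (ℕ.*-identityˡ g)) (trans (cong (ℕ._* g) (sym u≡1)) u*g≡m)

coprime-square-∣ : ∀ i j e .{{_ : NonZero e}} → gcd ∣ i ∣ e ≡ 1 →
  + (e ℕ.^ 2) ℤᵘ.∣ i ℤ.* (j ℤ.* j) → + e ℤᵘ.∣ j
coprime-square-∣ i j e gcd≡1 e²∣ij² = m*m∣n*n⇒m∣n e ∣ j ∣ (coprime-divisor e²⊥i e²∣ij²′)
  where
  e⊥i : Coprime e ∣ i ∣
  e⊥i = Coprime.sym (gcd≡1⇒coprime gcd≡1)
  e²⊥i : Coprime (e ℕ.* e) ∣ i ∣
  e²⊥i = coprime-* e⊥i e⊥i
  e²∣ij²′ : e ℕ.* e ℕ.∣ ∣ i ∣ ℕ.* (∣ j ∣ ℕ.* ∣ j ∣)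
  e²∣ij²′ = subst₂ ℕ._∣_ (cong (e ℕ.*_) (ℕ.*-identityʳ e))
    (trans (ℤ.abs-* i (j ℤ.* j)) (cong (∣ i ∣ ℕ.*_) (ℤ.abs-* j j))) e²∣ij²

τ-isInteger : ∀ n e e′ .{{_ : NonZero e}} → + e′ ℤᵘ.∣ + 2 ℤ.* n ℤ.* + e → IsInteger (τ n e e′)
τ-isInteger n e e′ e′∣2ne with F e e′ ≟ 0ℚ
... | yes _ = + 0 , refl
... | no F≢0 = t , (begin
  ι (+ 2 ℤ.* n) ÷ F e e′        ≡⟨ cong (_÷ F e e′) t*F≡2n ⟨
  ι t * F e e′ ÷ F e e′         ≡⟨ *-÷-cancelʳ (ι t) (F e e′) ⟩
  ι t                           ∎)
  where
  open ≡-Reasoning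
  instance _ = ℚ.≢-nonZero F≢0
  ε = ι (+ e)
  instance _ = ℚ.≢-nonZero (ι-pos≢0 e)
  e′∣ˢ2ne = ℤˢ.∣ᵤ⇒∣ {+ e′} {+ 2 ℤ.* n ℤ.* + e} e′∣2ne
  t = ℤˢ.quotient e′∣ˢ2ne
  t*F≡2n : ι t * F e e′ ≡ ι (+ 2 ℤ.* n)
  t*F≡2n = *-cancelʳ-≡ ε (begin
    ι t * F e e′ * ε        ≡⟨ ℚ.*-assoc (ι t) (F e e′) ε ⟩
    ι t * (F e e′ * ε)      ≡⟨ cong (ι t *_) (trans (ℚ.*-comm (F e e′) ε) (frac-*-cancel (+ e′) e)) ⟩
    ι t * ι (+ e′)          ≡⟨ ι-* t (+ e′) ⟨
    ι (t ℤ.* + e′)          ≡⟨ cong ι (ℤˢ._∣_.equality e′∣ˢ2ne) ⟨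
    ι (+ 2 ℤ.* n ℤ.* + e)   ≡⟨ ι-* (+ 2 ℤ.* n) (+ e) ⟩
    ι (+ 2 ℤ.* n) * ε       ∎)

theorem1p7 : (E : Curve) → NonSingular E → (P : Pt) → OnCurve E P → InfiniteOrder E P →
    (k : ℕ) → (mₖ₋₁ nₖ₋₁ : ℤ) → (eₖ₋₁ : ℕ) → (mₖ nₖ : ℤ) → (eₖ : ℕ) →
    Rep (pow2 E k P) mₖ₋₁ nₖ₋₁ eₖ₋₁ → Rep (pow2 E (suc k) P) mₖ nₖ eₖ →
    IsInteger (τ nₖ₋₁ eₖ₋₁ eₖ)
theorem1p7 E _ P _ _ k m n e m′ _ e′ (1≤e , _ , _ , Q≡) (1≤e′ , gcd[m′,e′]≡1 , _ , 2Q≡) =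
  τ-isInteger n e e′ e′∣D
  where
  instance _ = ℕ.>-nonZero 1≤e
  instance _ = ℕ.>-nonZero 1≤e′
  instance _ = ℕ.m^n≢0 e′ 2
  D = + 2 ℤ.* n ℤ.* + e
  x₂D²∈ℤ : IsInteger (frac m′ (e′ ℕ.^ 2) * ι (D ℤ.* D))
  x₂D²∈ℤ = doubling-x-isInteger E m n e (subst (λ Q → add E Q Q ≡ _) Q≡ 2Q≡)
  e′∣D : + e′ ℤᵘ.∣ D
  e′∣D = coprime-square-∣ m′ D e′ gcd[m′,e′]≡1
           (frac-*-isInteger⇒∣ m′ (e′ ℕ.^ 2) (D ℤ.* D) x₂D²∈ℤ)
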